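{- The sequences $(D_n)_{n\ge0}$, $(S_n)_{n\ge0}$ and $(C_n)_{n\ge0}$ are all strictly log-convex, i.e. each sequence $(u_n)$ among them satisfies $u_{n-1}u_{n+1}>u_n^2$ for all $n\ge1$.
   Context: The Delannoy numbers $D(n,k)$ are defined by $\sum_{n,k\ge0}D(n,k)x^ny^k=\frac{1}{1-x-y-xy}$. For $n,k\ge0$, $S(n,k)$ is the number of $(x_1,\dots,x_k)\in\mathbb{Z}^k$ with $|x_1|+\cdots+|x_k|=n$, and $C(n,k)=S(n,k+1)$. Set $D_n=D(n,n)$, $S_n=S(n,n)$, $C_n=C(n,n)$; e.g. $(D_n)=(1,3,13,63,321,\dots)$, $(S_n)=(1,2,8,38,192,\dots)$, $(C_n)=(1,4,18,88,450,\dots)$. -}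

module Defs where

open import Data.Nat using (ℕ; zero; suc; _+_; _*_; _≡ᵇ_)
open import Data.Integer using (ℤ; +_; -[1+_]; ∣_∣)
open import Data.List using (List; []; _∷_; map; concatMap; filter; length; upTo)
open import Data.Nat.ListAction using (sum)
open import Data.Vec using (Vec; []; _∷_; toList)
open import Data.Bool using (Bool; true; false)
open import Relation.Nullary.Decidable using (Dec)
import Data.Nat as N

-- Delannoy numbers: D(n,k) is the coefficient of x^n y^k in 1/(1-x-y-xy),
-- i.e. the unique array with D(0,0)=1 and
-- D(n,k) = D(n-1,k) + D(n,k-1) + D(n-1,k-1) (terms with a negative index are 0).
Del : ℕ → ℕ → ℕ
Del zero    zero    = 1
Del zero    (suc k) = Del zero k
Del (suc n) zero    = Del n zero
Del (suc n) (suc k) = Del n (suc k) + Del (suc n) k + Del n k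

intRange : ℕ → List ℤ
intRange n = map +_ (upTo (suc n)) Data.List.++ map -[1+_] (upTo n)

boxTuples : ℕ → (k : ℕ) → List (Vec ℤ k)
boxTuples n zero    = [] ∷ []
boxTuples n (suc k) = concatMap (λ x → map (x ∷_) (boxTuples n k)) (intRange n)

absSum : ∀ {k} → Vec ℤ k → ℕ
absSum v = sum (map ∣_∣ (toList v))

-- S(n,k) = #{ (x_1..x_k) ∈ ℤ^k : |x_1|+...+|x_k| = n }
-- (any such tuple has all |x_i| ≤ n, so it suffices to count inside the box)
S : ℕ → ℕ → ℕ
S n k = length (filter (λ v → absSum v N.≟ n) (boxTuples n k))

C : ℕ → ℕ → ℕ
C n k = S n (suc k)

Dn Sn Cn : ℕ → ℕ
Dn n = Del n n
Sn n = S n n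
Cn n = C n n

StrictlyLogConvex : (ℕ → ℕ) → Set
StrictlyLogConvex u = (n : ℕ) → u (suc n) * u (suc n) N.< u n * u (suc (suc n))

-- Counting tuples by their first coordinate gives S(n, k+1) = D(n, k) + D(n-1, k), so that
-- D_{m+1} = D_m + 2 D(m+1, m) and S_{m+1}, C_{m+1} are D_m + β D(m+1, m) for β = 1, 3.
-- The row recurrence of the Delannoy numbers turns (D_m, D(m+1, m)) into a first-order
-- linear system, and for f = D_m + β D(m+1, m) one polynomial identity expresses
-- f_{j+1} f_{j+3} - f_{j+2}^2 as a positive multiple of f_j f_{j+2} - f_{j+1}^2 plus a
-- positive remainder, so strict log-convexity propagates from j = 0.
module Submission where

open import Defs
open import Data.Product using (_×_; _,_; proj₁; proj₂)
open import Data.Nat using (ℕ; zero; suc; _+_; _*_; _≤_; _<_; _≟_; _<?_; s≤s; z<s)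
open import Data.Nat.Properties
open import Data.Nat.Tactic.RingSolver using (solve-∀)
open import Data.Nat.ListAction using (sum)
open import Data.Nat.ListAction.Properties using (sum-++)
open import Data.Integer using (ℤ; -[1+_]; ∣_∣) renaming (+_ to +ℤ_)
open import Data.List using (List; []; _∷_; _++_; map; concatMap; filter; length; applyUpTo)
open import Data.List.Properties using (map-++; map-∘; map-cong)
open import Data.Vec using (Vec; _∷_)
open import Data.Bool using (true; false; if_then_else_)
open import Function using (_∘_)
open import Relation.Nullary.Decidable using (Dec; does; from-yes)
open import Relation.Unary using (Pred; Decidable)
open import Relation.Binary.PropositionalEquality

indicator : ∀ {p} {P : Set p} → Dec P → ℕ
indicator P? = if does P? then 1 else 0

length-filter≡sum-indicator : ∀ {a p} {A : Set a} {P : Pred A p} (P? : Decidable P) (xs : List A) →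
                              length (filter P? xs) ≡ sum (map (indicator ∘ P?) xs)
length-filter≡sum-indicator P? [] = refl
length-filter≡sum-indicator P? (x ∷ xs) with does (P? x)
... | true  = cong suc (length-filter≡sum-indicator P? xs)
... | false = length-filter≡sum-indicator P? xs

sum-map-zero : ∀ {a} {A : Set a} (xs : List A) → sum (map (λ _ → 0) xs) ≡ 0
sum-map-zero []       = refl
sum-map-zero (x ∷ xs) = sum-map-zero xs

sum-concatMap : ∀ {a b} {A : Set a} {B : Set b} (g : B → ℕ) (F : A → List B) (xs : List A) →
                sum (map g (concatMap F xs)) ≡ sum (map (sum ∘ map g ∘ F) xs)
sum-concatMap g F []       = refl
sum-concatMap g F (x ∷ xs) = begin
  sum (map g (F x ++ concatMap F xs))               ≡⟨ cong sum (map-++ g (F x) (concatMap F xs)) ⟩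
  sum (map g (F x) ++ map g (concatMap F xs))       ≡⟨ sum-++ (map g (F x)) _ ⟩
  sum (map g (F x)) + sum (map g (concatMap F xs))  ≡⟨ cong (sum (map g (F x)) +_) (sum-concatMap g F xs) ⟩
  sum (map g (F x)) + sum (map (sum ∘ map g ∘ F) xs) ∎
  where open ≡-Reasoning

sumBelow : ℕ → (ℕ → ℕ) → ℕ
sumBelow zero    g = 0
sumBelow (suc N) g = g 0 + sumBelow N (g ∘ suc)

partialSum : (ℕ → ℕ) → ℕ → ℕ
partialSum e zero    = e 0
partialSum e (suc n) = partialSum e n + e (suc n)

sumBelow-zero : ∀ N → sumBelow N (λ _ → 0) ≡ 0
sumBelow-zero zero    = refl
sumBelow-zero (suc N) = sumBelow-zero N

sum-map-applyUpTo : ∀ {a} {A : Set a} (g : A → ℕ) (h : ℕ → A) N → sum (map g (applyUpTo h N)) ≡ sumBelow N (g ∘ h)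
sum-map-applyUpTo g h zero    = refl
sum-map-applyUpTo g h (suc N) = cong (g (h 0) +_) (sum-map-applyUpTo g (h ∘ suc) N)

sum-intRange : ∀ (g : ℕ → ℕ) m → sum (map (g ∘ ∣_∣) (intRange m)) ≡ sumBelow (suc m) g + sumBelow m (g ∘ suc)
sum-intRange g m = begin
  sum (map (g ∘ ∣_∣) (map +ℤ_ (upTo′ (suc m)) ++ map -[1+_] (upTo′ m)))
    ≡⟨ cong sum (map-++ (g ∘ ∣_∣) (map +ℤ_ (upTo′ (suc m))) (map -[1+_] (upTo′ m))) ⟩
  sum (map (g ∘ ∣_∣) (map +ℤ_ (upTo′ (suc m))) ++ map (g ∘ ∣_∣) (map -[1+_] (upTo′ m)))
    ≡⟨ sum-++ (map (g ∘ ∣_∣) (map +ℤ_ (upTo′ (suc m)))) _ ⟩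
  sum (map (g ∘ ∣_∣) (map +ℤ_ (upTo′ (suc m)))) + sum (map (g ∘ ∣_∣) (map -[1+_] (upTo′ m)))
    ≡⟨ cong₂ _+_ (cong sum (sym (map-∘ (upTo′ (suc m))))) (cong sum (sym (map-∘ (upTo′ m)))) ⟩
  sum (map g (upTo′ (suc m))) + sum (map (g ∘ suc) (upTo′ m))
    ≡⟨ cong₂ _+_ (sum-map-applyUpTo g (λ i → i) (suc m)) (sum-map-applyUpTo (g ∘ suc) (λ i → i) m) ⟩
  sumBelow (suc m) g + sumBelow m (g ∘ suc) ∎
  where
  open ≡-Reasoning
  upTo′ : ℕ → List ℕ
  upTo′ = applyUpTo (λ i → i)

delay : ℕ → (ℕ → ℕ) → ℕ → ℕ
delay zero    e n       = e n
delay (suc i) e zero    = 0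
delay (suc i) e (suc n) = delay i e n

indicator-+ : ∀ i s n → indicator (i + s ≟ n) ≡ delay i (λ t → indicator (s ≟ t)) n
indicator-+ zero    s n       = refl
indicator-+ (suc i) s zero    = refl
indicator-+ (suc i) s (suc n) = indicator-+ i s n

sum-map-delay : ∀ {a} {A : Set a} (e : A → ℕ → ℕ) (xs : List A) i n →
                sum (map (λ x → delay i (e x) n) xs) ≡ delay i (λ t → sum (map (λ x → e x t) xs)) n
sum-map-delay e xs zero    n       = refl
sum-map-delay e xs (suc i) zero    = sum-map-zero xs
sum-map-delay e xs (suc i) (suc n) = sum-map-delay e xs i n

delay-cong : ∀ i {e e′} n → (∀ t → t ≤ n → e t ≡ e′ t) → delay i e n ≡ delay i e′ n
delay-cong zero    n       e≗e′ = e≗e′ n ≤-refl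
delay-cong (suc i) zero    e≗e′ = refl
delay-cong (suc i) (suc n) e≗e′ = delay-cong i n (λ t t≤n → e≗e′ t (m≤n⇒m≤1+n t≤n))

sumBelow-delay : ∀ e {N} n → n < N → sumBelow N (λ i → delay i e n) ≡ partialSum e n
sumBelow-delay e {suc N} zero    _         = trans (cong (e 0 +_) (sumBelow-zero N)) (+-identityʳ (e 0))
sumBelow-delay e {suc N} (suc n) (s≤s n<N) = begin
  e (suc n) + sumBelow N (λ i → delay i e n) ≡⟨ cong (e (suc n) +_) (sumBelow-delay e n n<N) ⟩
  e (suc n) + partialSum e n                 ≡⟨ +-comm (e (suc n)) _ ⟩
  partialSum e n + e (suc n)                 ∎
  where open ≡-Reasoning

-- Counting lattice points on the ℓ¹-sphere

count : ∀ {k} → List (Vec ℤ k) → ℕ → ℕ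
count vs n = sum (map (λ v → indicator (absSum v ≟ n)) vs)

S≡count : ∀ n k → S n k ≡ count (boxTuples n k) n
S≡count n k = length-filter≡sum-indicator (λ v → absSum v ≟ n) (boxTuples n k)

count-map-∷ : ∀ {k} (x : ℤ) (vs : List (Vec ℤ k)) n → count (map (x ∷_) vs) n ≡ delay ∣ x ∣ (count vs) n
count-map-∷ x vs n = begin
  sum (map (λ v → indicator (absSum v ≟ n)) (map (x ∷_) vs))  ≡⟨ cong sum (sym (map-∘ vs)) ⟩
  sum (map (λ v → indicator (∣ x ∣ + absSum v ≟ n)) vs)            ≡⟨ cong sum (map-cong (λ v → indicator-+ ∣ x ∣ (absSum v) n) vs) ⟩
  sum (map (λ v → delay ∣ x ∣ (λ t → indicator (absSum v ≟ t)) n) vs)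
    ≡⟨ sum-map-delay (λ v t → indicator (absSum v ≟ t)) vs ∣ x ∣ n ⟩
  delay ∣ x ∣ (count vs) n                                          ∎
  where open ≡-Reasoning

-- sphereSize k n = S(n, k), in closed form through the Delannoy numbers
sphereSize : ℕ → ℕ → ℕ
sphereSize zero    zero    = 1
sphereSize zero    (suc n) = 0
sphereSize (suc k) zero    = Del zero k
sphereSize (suc k) (suc n) = Del (suc n) k + Del n k

partialSum-sphereSize : ∀ k n → partialSum (sphereSize k) n ≡ Del n k
partialSum-sphereSize zero    zero    = refl
partialSum-sphereSize zero    (suc n) = trans (+-identityʳ _) (partialSum-sphereSize zero n)
partialSum-sphereSize (suc k) zero    = refl
partialSum-sphereSize (suc k) (suc n) = begin
  partialSum (sphereSize (suc k)) n + (Del (suc n) k + Del n k) ≡⟨ cong (_+ (Del (suc n) k + Del n k)) (partialSum-sphereSize (suc k) n) ⟩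
  Del n (suc k) + (Del (suc n) k + Del n k)                      ≡⟨ +-assoc (Del n (suc k)) _ _ ⟨
  Del n (suc k) + Del (suc n) k + Del n k                        ∎
  where open ≡-Reasoning

-- the first coordinate x contributes |x| = i to the absolute sum, for i = 0 once and for i > 0 twice
sphereSize-suc : ∀ k {m} n → n ≤ m →
                 sumBelow (suc m) (λ i → delay i (sphereSize k) n) + sumBelow m (λ i → delay (suc i) (sphereSize k) n)
                   ≡ sphereSize (suc k) n
sphereSize-suc k {m} zero    _   = begin
  sumBelow (suc m) (λ i → delay i (sphereSize k) 0) + sumBelow m (λ _ → 0)
    ≡⟨ cong₂ _+_ (sumBelow-delay (sphereSize k) 0 (z<s {m})) (sumBelow-zero m) ⟩
  partialSum (sphereSize k) 0 + 0 ≡⟨ +-identityʳ _ ⟩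
  partialSum (sphereSize k) 0     ≡⟨ partialSum-sphereSize k 0 ⟩
  Del 0 k                         ∎
  where open ≡-Reasoning
sphereSize-suc k {m} (suc n) n<m =
  cong₂ _+_ (trans (sumBelow-delay (sphereSize k) (suc n) (s≤s n<m)) (partialSum-sphereSize k (suc n)))
            (trans (sumBelow-delay (sphereSize k) n n<m) (partialSum-sphereSize k n))

count-boxTuples : ∀ k {m} n → n ≤ m → count (boxTuples m k) n ≡ sphereSize k n
count-boxTuples zero    zero    _   = refl
count-boxTuples zero    (suc n) _   = refl
count-boxTuples (suc k) {m} n n≤m = begin
  count (concatMap (λ x → map (x ∷_) (boxTuples m k)) (intRange m)) n
    ≡⟨ sum-concatMap (λ v → indicator (absSum v ≟ n)) (λ x → map (x ∷_) (boxTuples m k)) (intRange m) ⟩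
  sum (map (λ x → count (map (x ∷_) (boxTuples m k)) n) (intRange m))
    ≡⟨ cong sum (map-cong (λ x → trans (count-map-∷ x (boxTuples m k) n) (delay-cong ∣ x ∣ n inner)) (intRange m)) ⟩
  sum (map (λ x → delay ∣ x ∣ (sphereSize k) n) (intRange m))
    ≡⟨ sum-intRange (λ i → delay i (sphereSize k) n) m ⟩
  sumBelow (suc m) (λ i → delay i (sphereSize k) n) + sumBelow m (λ i → delay (suc i) (sphereSize k) n)
    ≡⟨ sphereSize-suc k n n≤m ⟩
  sphereSize (suc k) n ∎
  where
  open ≡-Reasoning
  inner : ∀ t → t ≤ n → count (boxTuples m k) t ≡ sphereSize k t
  inner t t≤n = count-boxTuples k t (≤-trans t≤n n≤m)

S-suc : ∀ n k → S (suc n) (suc k) ≡ Del (suc n) k + Del n k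
S-suc n k = trans (S≡count (suc n) (suc k)) (count-boxTuples (suc k) (suc n) ≤-refl)

-- Delannoy numbers

Del-zeroˡ : ∀ k → Del 0 k ≡ 1
Del-zeroˡ zero    = refl
Del-zeroˡ (suc k) = Del-zeroˡ k

Del-zeroʳ : ∀ n → Del n 0 ≡ 1
Del-zeroʳ zero    = refl
Del-zeroʳ (suc n) = Del-zeroʳ n

Del-sym : ∀ n k → Del n k ≡ Del k n
Del-sym zero    zero    = refl
Del-sym zero    (suc k) = trans (Del-zeroˡ k) (sym (Del-zeroʳ k))
Del-sym (suc n) zero    = trans (Del-zeroʳ n) (sym (Del-zeroˡ n))
Del-sym (suc n) (suc k) = begin
  Del n (suc k) + Del (suc n) k + Del n k ≡⟨ cong₂ _+_ (cong₂ _+_ (Del-sym n (suc k)) (Del-sym (suc n) k)) (Del-sym n k) ⟩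
  Del (suc k) n + Del k (suc n) + Del k n ≡⟨ cong (_+ Del k n) (+-comm (Del (suc k) n) (Del k (suc n))) ⟩
  Del k (suc n) + Del (suc k) n + Del k n ∎
  where open ≡-Reasoning

Del-oneˡ : ∀ k → Del 1 k ≡ 1 + 2 * k
Del-oneˡ zero    = refl
Del-oneˡ (suc k) rewrite Del-zeroˡ k | Del-oneˡ k = arithmetic k
  where
  arithmetic : ∀ k → 1 + (1 + 2 * k) + 1 ≡ 1 + 2 * suc k
  arithmetic = solve-∀

Del-twoˡ : ∀ k → Del 2 k ≡ 1 + 2 * k + 2 * k * k
Del-twoˡ zero    = refl
Del-twoˡ (suc k) rewrite Del-oneˡ (suc k) | Del-twoˡ k | Del-oneˡ k = arithmetic k
  where
  arithmetic : ∀ k → 1 + 2 * suc k + (1 + 2 * k + 2 * k * k) + (1 + 2 * k) ≡ 1 + 2 * suc k + 2 * suc k * suc k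
  arithmetic = solve-∀

Del-row-recurrence : ∀ k n → (2 + n) * Del (2 + n) k ≡ (1 + 2 * k) * Del (1 + n) k + (1 + n) * Del n k
Del-row-recurrence k zero rewrite Del-twoˡ k | Del-oneˡ k | Del-zeroˡ k = arithmetic k
  where
  arithmetic : ∀ k → 2 * (1 + 2 * k + 2 * k * k) ≡ (1 + 2 * k) * (1 + 2 * k) + 1 * 1
  arithmetic = solve-∀
Del-row-recurrence zero (suc n) = arithmetic n (Del n 0)
  where
  arithmetic : ∀ n x → (3 + n) * x ≡ (1 + 2 * 0) * x + (2 + n) * x
  arithmetic = solve-∀
-- Adding the three instances of the induction hypothesis to both sides turns the claim into a
-- polynomial identity in the five values of Del the three recursive calls bottom out in.
Del-row-recurrence (suc k) (suc n) =
  +-cancelʳ-≡ _ _ _ (trans (cong ((3 + n) * Del (3 + n) (suc k) +_) (cong₂ _+_ (cong₂ _+_ (Del-row-recurrence k (suc n)) (Del-row-recurrence (suc k) n)) (Del-row-recurrence k n)))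
                           (identity k n (Del n (suc k)) (Del (3 + n) k) (Del (2 + n) k) (Del (1 + n) k) (Del n k)))
  where
  identity : ∀ k n R Y U V W →
    let D₁ = R + V + W ; D₂ = D₁ + U + V ; D₃ = D₂ + Y + U in
    (3 + n) * D₃ + ((1 + 2 * k) * U + (2 + n) * V + ((1 + 2 * suc k) * D₁ + (1 + n) * R) + ((1 + 2 * k) * V + (1 + n) * W))
      ≡ (1 + 2 * suc k) * D₂ + (2 + n) * D₁ + ((3 + n) * Y + (2 + n) * D₂ + (2 + n) * U)
  identity = solve-∀

Dn⁺ : ℕ → ℕ
Dn⁺ m = Del (suc m) m

Dn-suc : ∀ m → Dn (suc m) ≡ Dn m + 2 * Dn⁺ m
Dn-suc m = begin
  Del m (suc m) + Dn⁺ m + Dn m ≡⟨ cong (λ x → x + Dn⁺ m + Dn m) (Del-sym m (suc m)) ⟩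
  Dn⁺ m + Dn⁺ m + Dn m         ≡⟨ arithmetic (Dn m) (Dn⁺ m) ⟩
  Dn m + 2 * Dn⁺ m             ∎
  where
  open ≡-Reasoning
  arithmetic : ∀ x y → y + y + x ≡ x + 2 * y
  arithmetic = solve-∀

Dn⁺-suc : ∀ m → (2 + m) * Dn⁺ (suc m) ≡ (3 + 2 * m) * Dn (suc m) + (1 + m) * Dn⁺ m
Dn⁺-suc m = begin
  (2 + m) * Del (2 + m) (suc m)                                 ≡⟨ Del-row-recurrence (suc m) m ⟩
  (1 + 2 * suc m) * Dn (suc m) + (1 + m) * Del m (suc m)        ≡⟨ cong₂ (λ c x → c * Dn (suc m) + (1 + m) * x) (cong (1 +_) (*-suc 2 m)) (Del-sym m (suc m)) ⟩
  (3 + 2 * m) * Dn (suc m) + (1 + m) * Dn⁺ m                    ∎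
  where open ≡-Reasoning

-- Strict log-convexity

StrictlyLogConvex-resp : ∀ {u v} → (∀ n → u n ≡ v n) → StrictlyLogConvex u → StrictlyLogConvex v
StrictlyLogConvex-resp u≗v lc n =
  subst₂ _<_ (cong₂ _*_ (u≗v _) (u≗v _)) (cong₂ _*_ (u≗v n) (u≗v _)) (lc n)

StrictlyLogConvex-cons : ∀ {u} → u 1 * u 1 < u 0 * u 2 → StrictlyLogConvex (u ∘ suc) → StrictlyLogConvex u
StrictlyLogConvex-cons base lc zero    = base
StrictlyLogConvex-cons base lc (suc n) = lc n

weighted-< : ∀ k l {x y z w r} → k * x + l * y ≡ k * z + l * w + suc r → y ≤ w → z < x
weighted-< k l {x} {y} {z} {w} {r} eq y≤w = *-cancelˡ-< k z x (+-cancelʳ-≤ (l * y) (suc (k * z)) (k * x) (begin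
  suc (k * z) + l * y         ≤⟨ +-monoʳ-≤ (suc (k * z)) (*-monoʳ-≤ l y≤w) ⟩
  suc (k * z + l * w)         ≤⟨ s≤s (m≤m+n (k * z + l * w) r) ⟩
  suc (k * z + l * w + r)     ≡⟨ +-suc (k * z + l * w) r ⟨
  k * z + l * w + suc r       ≡⟨ eq ⟨
  k * x + l * y               ∎))
  where open ≤-Reasoning

-- One step of the system (u_i, v_i) ↦ (u_{i+1}, v_{i+1}) given by u_{i+1} = u_i + 2 v_i and
-- (2 + i) v_{i+1} = (3 + 2i) u_{i+1} + (1 + i) v_i, applied to (s u_i, s v_i) and yielding
-- (s (2 + i) u_{i+1}, s (2 + i) v_{i+1}); this keeps all values integral.
advance : ℕ → ℕ × ℕ → ℕ × ℕ
advance i (A , B) = (2 + i) * (A + 2 * B) , (3 + 2 * i) * (A + 2 * B) + (1 + i) * B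

advance* : ℕ → ℕ → ℕ × ℕ → ℕ × ℕ
advance* j zero    p = p
advance* j (suc k) p = advance (k + j) (advance* j k p)

combine : ℕ → ℕ × ℕ → ℕ
combine β (A , B) = A + β * B

-- Read through F_k = (2 + j) ⋯ (1 + j + k) f_{j+k}, this says that a positive multiple of
-- f_{j+1} f_{j+3} - f_{j+2}^2 equals a positive multiple of f_j f_{j+2} - f_{j+1}^2 plus R.
-- R has positive coefficients and a visibly nonzero A₀² coefficient, so it normalises to a
-- successor as soon as A₀ does.
key-identity : ∀ j β A₀ B₀ →
  let A₁ = (2 + j) * (A₀ + 2 * B₀)
      B₁ = (3 + 2 * j) * (A₀ + 2 * B₀) + (1 + j) * B₀
      A₂ = (2 + (1 + j)) * (A₁ + 2 * B₁)
      B₂ = (3 + 2 * (1 + j)) * (A₁ + 2 * B₁) + (1 + (1 + j)) * B₁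
      A₃ = (2 + (2 + j)) * (A₂ + 2 * B₂)
      B₃ = (3 + 2 * (2 + j)) * (A₂ + 2 * B₂) + (1 + (2 + j)) * B₂
      F₀ = A₀ + β * B₀
      F₁ = A₁ + β * B₁
      F₂ = A₂ + β * B₂
      F₃ = A₃ + β * B₃
      coefficient : ℕ → ℕ → ℕ → ℕ
      coefficient c₀ c₁ c₂ = (2 + j) * (3 + j) * ((4 + j) * c₀ + β * c₁) + β * β * (1 + j) * c₂
      R = coefficient (22 + 14 * j) (236 + 256 * j + 68 * j * j) (496 + 773 * j + 395 * j * j + 66 * j * j * j) * (A₀ * A₀)
        + coefficient (94 + 62 * j) (1004 + 1112 * j + 300 * j * j) (2392 + 3782 * j + 1956 * j * j + 330 * j * j * j) * (A₀ * B₀)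
        + coefficient (100 + 68 * j) (1064 + 1200 * j + 328 * j * j) (2872 + 4613 * j + 2417 * j * j + 412 * j * j * j) * (B₀ * B₀)
  in  (2 + j) * ((3 + j) * (F₁ * F₃)) + (1 + j) * (3 + j) * (4 + j) * ((3 + j) * (F₁ * F₁))
    ≡ (2 + j) * ((4 + j) * (F₂ * F₂)) + (1 + j) * (3 + j) * (4 + j) * ((2 + j) * (F₀ * F₂)) + R
key-identity = solve-∀

advance*-log-convex-step : ∀ j β {A B} → 0 < A →
  let F : ℕ → ℕ
      F k = combine β (advance* j k (A , B))
  in (3 + j) * (F 1 * F 1) ≤ (2 + j) * (F 0 * F 2) → (4 + j) * (F 2 * F 2) < (3 + j) * (F 1 * F 3)
advance*-log-convex-step j β {suc A} {B} _ = weighted-< (2 + j) ((1 + j) * (3 + j) * (4 + j)) (key-identity j β (suc A) B)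

module LogConvexity (a b : ℕ → ℕ)
                    (a-suc : ∀ m → a (suc m) ≡ a m + 2 * b m)
                    (b-suc : ∀ m → (2 + m) * b (suc m) ≡ (3 + 2 * m) * a (suc m) + (1 + m) * b m)
                    where

  f : ℕ → ℕ → ℕ
  f β m = a m + β * b m

  Scaled : ℕ → ℕ → ℕ × ℕ → Set
  Scaled s i p = s * a i ≡ proj₁ p × s * b i ≡ proj₂ p

  advance-scaled : ∀ {s i p} → Scaled s i p → Scaled (s * (2 + i)) (suc i) (advance i p)
  advance-scaled {s} {i} {A , B} (sa≡A , sb≡B) = scaled-a , scaled-b
    where
    open ≡-Reasoning
    rearrange : ∀ s c x → s * c * x ≡ c * (s * x)
    rearrange = solve-∀
    distribute : ∀ s c d x y → s * (c * x + d * y) ≡ c * (s * x) + d * (s * y)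
    distribute = solve-∀
    distribute-a : ∀ s x y → s * (x + 2 * y) ≡ s * x + 2 * (s * y)
    distribute-a = solve-∀
    s·a-suc : s * a (suc i) ≡ A + 2 * B
    s·a-suc = begin
      s * a (suc i)             ≡⟨ cong (s *_) (a-suc i) ⟩
      s * (a i + 2 * b i)       ≡⟨ distribute-a s (a i) (b i) ⟩
      s * a i + 2 * (s * b i)   ≡⟨ cong₂ (λ x y → x + 2 * y) sa≡A sb≡B ⟩
      A + 2 * B                 ∎
    scaled-a : s * (2 + i) * a (suc i) ≡ (2 + i) * (A + 2 * B)
    scaled-a = trans (rearrange s (2 + i) (a (suc i))) (cong ((2 + i) *_) s·a-suc)
    scaled-b : s * (2 + i) * b (suc i) ≡ (3 + 2 * i) * (A + 2 * B) + (1 + i) * B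
    scaled-b = begin
      s * (2 + i) * b (suc i)                             ≡⟨ *-assoc s (2 + i) (b (suc i)) ⟩
      s * ((2 + i) * b (suc i))                           ≡⟨ cong (s *_) (b-suc i) ⟩
      s * ((3 + 2 * i) * a (suc i) + (1 + i) * b i)       ≡⟨ distribute s (3 + 2 * i) (1 + i) (a (suc i)) (b i) ⟩
      (3 + 2 * i) * (s * a (suc i)) + (1 + i) * (s * b i) ≡⟨ cong₂ (λ x y → (3 + 2 * i) * x + (1 + i) * y) s·a-suc sb≡B ⟩
      (3 + 2 * i) * (A + 2 * B) + (1 + i) * B             ∎

  scale : ℕ → ℕ → ℕ
  scale j zero    = 1
  scale j (suc k) = scale j k * (2 + (k + j))

  advance*-scaled : ∀ j k → Scaled (scale j k) (k + j) (advance* j k (a j , b j))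
  advance*-scaled j zero    = *-identityˡ (a j) , *-identityˡ (b j)
  advance*-scaled j (suc k) = advance-scaled {scale j k} {k + j} (advance*-scaled j k)

  combine-scaled : ∀ β {s i p} → Scaled s i p → combine β p ≡ s * f β i
  combine-scaled β {s} {i} {A , B} (sa≡A , sb≡B) = begin
    A + β * B               ≡⟨ cong₂ (λ x y → x + β * y) sa≡A sb≡B ⟨
    s * a i + β * (s * b i) ≡⟨ distribute s β (a i) (b i) ⟩
    s * (a i + β * b i)     ∎
    where
    open ≡-Reasoning
    distribute : ∀ s β x y → s * x + β * (s * y) ≡ s * (x + β * y)
    distribute = solve-∀

  module _ (a₀-pos : 0 < a 0) where

    a-pos : ∀ m → 0 < a m
    a-pos zero    = a₀-pos
    a-pos (suc m) = <-≤-trans (a-pos m) (subst (a m ≤_) (sym (a-suc m)) (m≤m+n (a m) (2 * b m)))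

    f-log-convex-step : ∀ β j → f β (1 + j) * f β (1 + j) ≤ f β j * f β (2 + j) →
                        f β (2 + j) * f β (2 + j) < f β (1 + j) * f β (3 + j)
    f-log-convex-step β j IH = *-cancelˡ-< c′ _ _ (begin-strict
        c′ * (f₂ * f₂)                           ≡⟨ pull (4 + j) s₂ s₂ f₂ f₂ ⟩
        (4 + j) * ((s₂ * f₂) * (s₂ * f₂))        ≡⟨ cong (λ x → (4 + j) * (x * x)) (F≡ 2) ⟨
        (4 + j) * (F 2 * F 2)                    <⟨ advance*-log-convex-step j β (a-pos j) scaled-IH ⟩
        (3 + j) * (F 1 * F 3)                    ≡⟨ cong₂ (λ x y → (3 + j) * (x * y)) (F≡ 1) (F≡ 3) ⟩
        (3 + j) * ((s₁ * f₁) * (s₃ * f₃))        ≡⟨ pull (3 + j) s₁ s₃ f₁ f₃ ⟨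
        (3 + j) * s₁ * s₃ * (f₁ * f₃)            ≡⟨ cong (_* (f₁ * f₃)) (constants′ j) ⟨
        c′ * (f₁ * f₃)                           ∎)
      where
      open ≤-Reasoning
      F : ℕ → ℕ
      F k = combine β (advance* j k (a j , b j))
      F≡ : ∀ k → F k ≡ scale j k * f β (k + j)
      F≡ k = combine-scaled β {scale j k} {k + j} (advance*-scaled j k)
      f₀ f₁ f₂ f₃ s₁ s₂ s₃ c c′ : ℕ
      f₀ = f β j
      f₁ = f β (1 + j)
      f₂ = f β (2 + j)
      f₃ = f β (3 + j)
      s₁ = scale j 1
      s₂ = scale j 2
      s₃ = scale j 3
      c  = (3 + j) * s₁ * s₁
      c′ = (4 + j) * s₂ * s₂
      pull : ∀ c s t x y → c * s * t * (x * y) ≡ c * ((s * x) * (t * y))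
      pull = solve-∀
      constants : ∀ j → (3 + j) * (1 * (2 + j)) * (1 * (2 + j)) ≡ (2 + j) * 1 * (1 * (2 + j) * (3 + j))
      constants = solve-∀
      constants′ : ∀ j → (4 + j) * (1 * (2 + j) * (3 + j)) * (1 * (2 + j) * (3 + j))
                         ≡ (3 + j) * (1 * (2 + j)) * (1 * (2 + j) * (3 + j) * (4 + j))
      constants′ = solve-∀
      scaled-IH : (3 + j) * (F 1 * F 1) ≤ (2 + j) * (F 0 * F 2)
      scaled-IH = begin
        (3 + j) * (F 1 * F 1)                 ≡⟨ cong (λ x → (3 + j) * (x * x)) (F≡ 1) ⟩
        (3 + j) * ((s₁ * f₁) * (s₁ * f₁))     ≡⟨ pull (3 + j) s₁ s₁ f₁ f₁ ⟨
        c * (f₁ * f₁)                         ≤⟨ *-monoʳ-≤ c IH ⟩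
        c * (f₀ * f₂)                         ≡⟨ cong (_* (f₀ * f₂)) (constants j) ⟩
        (2 + j) * 1 * s₂ * (f₀ * f₂)          ≡⟨ pull (2 + j) 1 s₂ f₀ f₂ ⟩
        (2 + j) * ((1 * f₀) * (s₂ * f₂))      ≡⟨ cong₂ (λ x y → (2 + j) * (x * y)) (F≡ 0) (F≡ 2) ⟨
        (2 + j) * (F 0 * F 2)                 ∎

    f-strictlyLogConvex : ∀ β → f β 1 * f β 1 < f β 0 * f β 2 → StrictlyLogConvex (f β)
    f-strictlyLogConvex β base zero    = base
    f-strictlyLogConvex β base (suc j) = f-log-convex-step β j (<⇒≤ (f-strictlyLogConvex β base j))

open LogConvexity Dn Dn⁺ Dn-suc Dn⁺-suc using (f; f-strictlyLogConvex)

-- Dn 0, Dn 1, Dn 2 = 1, 3, 13 and Dn⁺ 0, Dn⁺ 1, Dn⁺ 2 = 1, 5, 25.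
f-base : ∀ β → f β 1 * f β 1 < f β 0 * f β 2
f-base β = subst (f β 1 * f β 1 <_) (sym (values β)) (m<m+n _ z<s)
  where
  values : ∀ β → (1 + β * 1) * (13 + β * 25) ≡ (3 + β * 5) * (3 + β * 5) + suc (3 + 8 * β)
  values = solve-∀

Sn-suc : ∀ m → Sn (suc m) ≡ f 1 m
Sn-suc m = begin
  S (suc m) (suc m) ≡⟨ S-suc m m ⟩
  Dn⁺ m + Dn m      ≡⟨ +-comm (Dn⁺ m) (Dn m) ⟩
  Dn m + Dn⁺ m      ≡⟨ cong (Dn m +_) (*-identityˡ (Dn⁺ m)) ⟨
  Dn m + 1 * Dn⁺ m  ∎
  where open ≡-Reasoning

Cn-suc : ∀ m → Cn (suc m) ≡ f 3 m
Cn-suc m = begin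
  S (suc m) (suc (suc m))    ≡⟨ S-suc m (suc m) ⟩
  Dn (suc m) + Del m (suc m) ≡⟨ cong₂ _+_ (Dn-suc m) (Del-sym m (suc m)) ⟩
  Dn m + 2 * Dn⁺ m + Dn⁺ m   ≡⟨ arithmetic (Dn m) (Dn⁺ m) ⟩
  Dn m + 3 * Dn⁺ m           ∎
  where
  open ≡-Reasoning
  arithmetic : ∀ x y → x + 2 * y + y ≡ x + 3 * y
  arithmetic = solve-∀

mainTheorem14 : StrictlyLogConvex Dn × StrictlyLogConvex Sn × StrictlyLogConvex Cn
mainTheorem14 =
    StrictlyLogConvex-resp (λ m → +-identityʳ (Dn m)) (f-log-convex 0)
  , StrictlyLogConvex-cons {Sn} (from-yes (Sn 1 * Sn 1 <? Sn 0 * Sn 2)) (StrictlyLogConvex-resp (sym ∘ Sn-suc) (f-log-convex 1))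
  , StrictlyLogConvex-cons {Cn} (from-yes (Cn 1 * Cn 1 <? Cn 0 * Cn 2)) (StrictlyLogConvex-resp (sym ∘ Cn-suc) (f-log-convex 3))
  where
  f-log-convex : ∀ β → StrictlyLogConvex (f β)
  f-log-convex β = f-strictlyLogConvex z<s β (f-base β)
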